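{- Let $G$ be a $(d,k)$-digraph with repeat permutation $r$, let $\alpha>1$ be an integer, and let $H_\alpha$ be the subdigraph of $G$ induced by the vertices $w$ for which there is an integer $t\geq0$ with $\mathrm{ord}_r(w)\mid 2^t\alpha$. If $H_\alpha\neq C_k$, then $H_\alpha$ has diameter $k$.
   Context: A $(d,k)$-digraph (almost Moore digraph) is a finite digraph, diregular of degree $d>1$ (every vertex has in- and out-degree $d$), of diameter $k>1$ and order $N=d+d^2+\cdots+d^k$. Every vertex $v$ has a unique vertex $r(v)$ (its repeat) such that there are exactly two walks of length $\leq k$ from $v$ to $r(v)$, at least one of them of length $k$; $r$ is a permutation of $V(G)$ and an automorphism of $G$. A self-repeat is a vertex with $r(v)=v$. $\mathrm{ord}_r(v)$ is the least $t\geq1$ with $r^t(v)=v$. $C_k$ denotes the subdigraph of $G$ induced by the self-repeats of $G$ (for $k\geq3$, when $G$ has self-repeats, these are exactly $k$ vertices forming a directed cycle of length $k$). -}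

module Defs where

open import Data.Nat using (ℕ; zero; suc; _+_; _*_; _^_; _≤_; _<_)
open import Data.Nat.Divisibility using (_∣_)
open import Data.Fin using (Fin; zero; suc)
open import Data.Fin.Properties using (_≟_)
open import Data.Bool using (Bool; true; false; if_then_else_)
open import Data.Product using (Σ; ∃; ∃-syntax; _×_)
open import Data.Empty using (⊥)
open import Data.Unit using (⊤)
open import Relation.Nullary using (¬_)
open import Relation.Nullary.Decidable using (⌊_⌋)
open import Relation.Binary.PropositionalEquality using (_≡_; _≢_)
open import Function using (_∘_; id)

-- A (finite) digraph on vertex set Fin n, given by its adjacency relation
-- (A u v ≡ true iff there is an arc u → v; no multiple arcs, loops allowed).
Digraph : ℕ → Set
Digraph n = Fin n → Fin n → Bool

sumFin : (n : ℕ) → (Fin n → ℕ) → ℕ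
sumFin zero    f = 0
sumFin (suc n) f = f zero + sumFin n (f ∘ suc)

sumTo : ℕ → (ℕ → ℕ) → ℕ
sumTo zero    f = f 0
sumTo (suc m) f = sumTo m f + f (suc m)

mooreOrder : ℕ → ℕ → ℕ
mooreOrder d zero    = 0
mooreOrder d (suc k) = mooreOrder d k + d ^ suc k

indicator : Bool → ℕ
indicator true  = 1
indicator false = 0

outDeg : {n : ℕ} → Digraph n → Fin n → ℕ
outDeg {n} A u = sumFin n (λ w → indicator (A u w))

inDeg : {n : ℕ} → Digraph n → Fin n → ℕ
inDeg {n} A v = sumFin n (λ w → indicator (A w v))

Diregular : {n : ℕ} → Digraph n → ℕ → Set
Diregular A d = ∀ v → outDeg A v ≡ d × inDeg A v ≡ d

walks : {n : ℕ} → Digraph n → ℕ → Fin n → Fin n → ℕ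
walks A zero    u v = if ⌊ u ≟ v ⌋ then 1 else 0
walks {n} A (suc ℓ) u v = sumFin n (λ w → if A u w then walks A ℓ w v else 0)

walksUpTo : {n : ℕ} → Digraph n → ℕ → Fin n → Fin n → ℕ
walksUpTo A k u v = sumTo k (λ ℓ → walks A ℓ u v)

-- Walks of length ℓ from u to v all of whose vertices satisfy P
-- (i.e. walks in the subdigraph induced by P).
data WalkIn {n : ℕ} (A : Digraph n) (P : Fin n → Set) : ℕ → Fin n → Fin n → Set where
  nil  : ∀ {u} → P u → WalkIn A P zero u u
  cons : ∀ {ℓ u w v} → P u → A u w ≡ true → WalkIn A P ℓ w v → WalkIn A P (suc ℓ) u v

HasDiameterIn : {n : ℕ} → Digraph n → (Fin n → Set) → ℕ → Set
HasDiameterIn A P k =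
  (∀ u v → P u → P v → ∃[ ℓ ] (ℓ ≤ k × WalkIn A P ℓ u v)) ×
  (∃[ u ] ∃[ v ] (P u × P v × (∀ ℓ → ℓ < k → ¬ WalkIn A P ℓ u v)))

HasDiameter : {n : ℕ} → Digraph n → ℕ → Set
HasDiameter A k = HasDiameterIn A (λ _ → ⊤) k

-- A (d,k)-digraph: diregular of degree d > 1, diameter k > 1,
-- order d + d^2 + ... + d^k.
IsAlmostMoore : (n d k : ℕ) → Digraph n → Set
IsAlmostMoore n d k A =
  1 < d × 1 < k × n ≡ mooreOrder d k × Diregular A d × HasDiameter A k

IsRepeat : {n : ℕ} → Digraph n → ℕ → Fin n → Fin n → Set
IsRepeat A k v w = walksUpTo A k v w ≡ 2 × 1 ≤ walks A k v w

iter : {X : Set} → (X → X) → ℕ → X → X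
iter f zero    = id
iter f (suc t) = f ∘ iter f t

IsOrd : {n : ℕ} → (Fin n → Fin n) → Fin n → ℕ → Set
IsOrd r w m = 1 ≤ m × iter r m w ≡ w × (∀ j → 1 ≤ j → j < m → iter r j w ≢ w)

InH : {n : ℕ} → (Fin n → Fin n) → ℕ → Fin n → Set
InH r α w = ∃[ m ] (IsOrd r w m × ∃[ t ] (m ∣ 2 ^ t * α))

-- w is a self-repeat (vertex of C_k)
IsSelfRepeat : {n : ℕ} → (Fin n → Fin n) → Fin n → Set
IsSelfRepeat r w = r w ≡ w

-- Let S(u, v) be the number of walks of length ≤ k from u to v. Every S(u, v) ≥ 1 (diameter k) and
-- Σ_v S(u, v) = 1 + d + … + d^k = N + 1 (regularity), so S(u, v) = 1 + [v = r u]: the matrix S is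
-- J + P with P the permutation matrix of r. Since S commutes with the adjacency matrix A, so does P,
-- i.e. r is an automorphism.
--
-- H_α consists of the vertices fixed by φ = r^(2^N α), as an order m is at most N and m ∣ 2^t α
-- implies m ∣ 2^m α. If u, v ∈ H_α and W is a walk of length ≤ k from u to v, so are φW and φ²W; as
-- there are at most two such walks of the same length, W or φW is fixed by φ, or W is fixed by
-- φ² = r^(2^(N+1) α), and in each case it lies in H_α. If some w ∈ H_α is not a self-repeat, a walk
-- inside H_α from w to r w ≠ w starts with an arc w → x, x ∈ H_α; a walk from x back to w of length
-- < k would give a second closed walk of length ≤ k at w, forcing r w = w. Hence the distance from x
-- to w in H_α is k.

module Submission where

open import Defs
open import Data.Nat using (ℕ; _<_)
open import Data.Fin using (Fin)
open import Data.Product using (_×_)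
open import Function.Bundles using (_⇔_; mk⇔)
open import Relation.Nullary using (¬_)

open import Data.Bool using (true; false; if_then_else_)
open import Data.Nat using (_≤?_; zero; suc; _+_; _*_; _∸_; _^_; _≤_; z≤n; s≤s; s≤s⁻¹)
open import Data.Nat.Properties hiding (_≟_)
open import Data.Fin using (zero; suc; toℕ)
open import Data.Fin.Properties using (_≟_; pigeonhole; toℕ<n; ¬∀⟶∃¬)
open import Data.Product using (Σ; ∃-syntax; _,_; proj₁; proj₂)
open import Data.Nat.Divisibility
  using (_∣_; _∣?_; 1∣_; divides; m%n≡0⇒n∣m; ∣-trans; *-monoˡ-∣; *-monoʳ-∣; *-cancelˡ-∣)
open import Data.Nat.Coprimality using (Coprime; coprime-divisor)
open import Data.Nat.Primality using (Prime; prime[2]; prime⇒irreducible)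
open import Data.Nat.DivMod using (_%_; _/_; m%n<n; m≡m%n+[m/n]*n)
open import Data.Sum using (_⊎_; inj₁; inj₂; [_,_]′)
open import Data.Empty using (⊥-elim)
open import Data.Unit using (tt)
open import Function using (_∘_)
open import Data.Vec as Vec using (Vec; []; _∷_)
open import Data.Vec.Relation.Unary.All as VecAll using (All; []; _∷_)
open import Data.Vec.Properties using (∷-injective; map-∘) renaming (≡-dec to ≡-dec-Vec)
open import Data.List using (List; []; _∷_; length)
open import Data.List.Membership.Propositional using (_∈_)
open import Data.List.Relation.Unary.Any using (here; there)
import Data.List.Relation.Unary.All as ListAll
open ListAll using ([]; _∷_)
open import Data.List.Relation.Unary.AllPairs using ([]; _∷_)
open import Data.List.Relation.Unary.Unique.Propositional using (Unique)
open import Relation.Nullary using (yes; no; _×-dec_; _→-dec_; contradiction)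
open import Relation.Unary using (Decidable)
open import Relation.Nullary.Decidable as Dec using (⌊_⌋; decidable-stable)
open import Relation.Binary.PropositionalEquality
open import Algebra.Properties.Semiring.Sum +-*-semiring
  using (sum; sum-cong-≗; sum-replicate-zero; ∑-distrib-+; ∑-comm; *-distribˡ-sum; *-distribʳ-sum)

sumFin≡sum : ∀ n (f : Fin n → ℕ) → sumFin n f ≡ sum f
sumFin≡sum zero    f = refl
sumFin≡sum (suc n) f = cong (f zero +_) (sumFin≡sum n (f ∘ suc))

sum-ones : ∀ n → sum {n} (λ _ → 1) ≡ n
sum-ones zero    = refl
sum-ones (suc n) = cong suc (sum-ones n)

sum-mono-≤ : ∀ {n} {f g : Fin n → ℕ} → (∀ i → f i ≤ g i) → sum f ≤ sum g
sum-mono-≤ {zero}  f≤g = z≤n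
sum-mono-≤ {suc n} f≤g = +-mono-≤ (f≤g zero) (sum-mono-≤ (f≤g ∘ suc))

term≤sum : ∀ {n} (f : Fin n → ℕ) i → f i ≤ sum f
term≤sum f zero    = m≤m+n _ _
term≤sum f (suc i) = ≤-trans (term≤sum (f ∘ suc) i) (m≤n+m _ _)

two-terms≤sum : ∀ {n} (f : Fin n → ℕ) {i j} → i ≢ j → f i + f j ≤ sum f
two-terms≤sum f {zero}  {zero}  i≢j = ⊥-elim (i≢j refl)
two-terms≤sum f {zero}  {suc j} _   = +-monoʳ-≤ (f zero) (term≤sum (f ∘ suc) j)
two-terms≤sum f {suc i} {zero}  _   = ≤-trans (≤-reflexive (+-comm (f (suc i)) (f zero)))
                                              (+-monoʳ-≤ (f zero) (term≤sum (f ∘ suc) i))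
two-terms≤sum f {suc i} {suc j} i≢j = ≤-trans (two-terms≤sum (f ∘ suc) (i≢j ∘ cong suc)) (m≤n+m _ _)

δ : ∀ {n} → Fin n → Fin n → ℕ
δ a b = if ⌊ a ≟ b ⌋ then 1 else 0

δ-refl : ∀ {n} (a : Fin n) → δ a a ≡ 1
δ-refl a with a ≟ a
... | yes _   = refl
... | no  a≢a = ⊥-elim (a≢a refl)

δ≤1 : ∀ {n} (a b : Fin n) → δ a b ≤ 1
δ≤1 a b with a ≟ b
... | yes _ = ≤-refl
... | no  _ = z≤n

1≤δ⇒≡ : ∀ {n} {a b : Fin n} → 1 ≤ δ a b → a ≡ b
1≤δ⇒≡ {a = a} {b} 1≤δ with a ≟ b
... | yes a≡b = a≡b
1≤δ⇒≡ () | no _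

δ-suc : ∀ {n} (a b : Fin n) → δ (suc a) (suc b) ≡ δ a b
δ-suc a b with a ≟ b
... | yes _ = refl
... | no  _ = refl

δ-sym : ∀ {n} (a b : Fin n) → δ a b ≡ δ b a
δ-sym a b with a ≟ b | b ≟ a
... | yes _   | yes _   = refl
... | no  _   | no  _   = refl
... | yes a≡b | no  b≢a = ⊥-elim (b≢a (sym a≡b))
... | no  a≢b | yes b≡a = ⊥-elim (a≢b (sym b≡a))

sum-δ : ∀ {n} (a : Fin n) (f : Fin n → ℕ) → sum (λ w → δ a w * f w) ≡ f a
sum-δ {suc n} zero    f = trans (cong (f zero + 0 +_) (sum-replicate-zero n)) (trans (+-identityʳ _) (+-identityʳ _))
sum-δ {suc n} (suc a) f = trans (sum-cong-≗ (λ w → cong (_* f (suc w)) (δ-suc a w))) (sum-δ a (f ∘ suc))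

sum-δʳ : ∀ {n} (a : Fin n) (f : Fin n → ℕ) → sum (λ w → f w * δ w a) ≡ f a
sum-δʳ a f = trans (sum-cong-≗ (λ w → trans (*-comm (f w) (δ w a)) (cong (_* f w) (δ-sym w a)))) (sum-δ a f)

excess-at-one-point : ∀ {n} (f : Fin n → ℕ) {a} → (∀ i → 1 ≤ f i) → sum f ≡ suc n → 2 ≤ f a →
                      ∀ b → f b ≡ 1 + δ a b
excess-at-one-point {n} f {a} 1≤f Σf≡1+n 2≤fa b = trans (f≡1+g b) (cong suc (g≡δ b))
  where
  g : Fin n → ℕ
  g i = f i ∸ 1
  f≡1+g : ∀ i → f i ≡ 1 + g i
  f≡1+g i = sym (m+[n∸m]≡n (1≤f i))
  Σg≡1 : sum g ≡ 1
  Σg≡1 = +-cancelˡ-≡ n (sum g) 1 (begin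
    n + sum g                 ≡⟨ cong (_+ sum g) (sum-ones n) ⟨
    sum {n} (λ _ → 1) + sum g ≡⟨ ∑-distrib-+ (λ _ → 1) g ⟨
    sum (λ i → 1 + g i)       ≡⟨ sum-cong-≗ f≡1+g ⟨
    sum f                     ≡⟨ Σf≡1+n ⟩
    suc n                     ≡⟨ +-comm 1 n ⟩
    n + 1                     ∎)
    where open ≡-Reasoning
  1≤ga : 1 ≤ g a
  1≤ga = s≤s⁻¹ (subst (2 ≤_) (f≡1+g a) 2≤fa)
  g≡δ : ∀ b → g b ≡ δ a b
  g≡δ b with a ≟ b
  ... | yes refl = ≤-antisym (subst (g a ≤_) Σg≡1 (term≤sum g a)) 1≤ga
  ... | no  a≢b  = n≤0⇒n≡0 (+-cancelˡ-≤ 1 (g b) 0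
                     (≤-trans (+-monoˡ-≤ (g b) 1≤ga) (subst (g a + g b ≤_) Σg≡1 (two-terms≤sum g a≢b))))

sumTo-cong : ∀ k {f g : ℕ → ℕ} → (∀ i → f i ≡ g i) → sumTo k f ≡ sumTo k g
sumTo-cong zero    f≗g = f≗g 0
sumTo-cong (suc k) f≗g = cong₂ _+_ (sumTo-cong k f≗g) (f≗g (suc k))

sum-sumTo-comm : ∀ {n} k (h : ℕ → Fin n → ℕ) → sum (λ v → sumTo k (λ l → h l v)) ≡ sumTo k (λ l → sum (h l))
sum-sumTo-comm zero    h = refl
sum-sumTo-comm (suc k) h = trans (∑-distrib-+ (λ v → sumTo k (λ l → h l v)) (h (suc k)))
                                 (cong (_+ sum (h (suc k))) (sum-sumTo-comm k h))

*-distribˡ-sumTo : ∀ k c (f : ℕ → ℕ) → c * sumTo k f ≡ sumTo k (λ l → c * f l)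
*-distribˡ-sumTo zero    c f = refl
*-distribˡ-sumTo (suc k) c f = trans (*-distribˡ-+ c (sumTo k f) (f (suc k)))
                                     (cong (_+ c * f (suc k)) (*-distribˡ-sumTo k c f))

*-distribʳ-sumTo : ∀ k c (f : ℕ → ℕ) → sumTo k f * c ≡ sumTo k (λ l → f l * c)
*-distribʳ-sumTo k c f = trans (*-comm (sumTo k f) c)
                               (trans (*-distribˡ-sumTo k c f) (sumTo-cong k (λ l → *-comm c (f l))))

term≤sumTo : ∀ k (f : ℕ → ℕ) {l} → l ≤ k → f l ≤ sumTo k f
term≤sumTo zero    f z≤n = ≤-refl
term≤sumTo (suc k) f {l} l≤1+k with m≤n⇒m<n∨m≡n l≤1+k
... | inj₁ l<1+k = ≤-trans (term≤sumTo k f (≤-pred l<1+k)) (m≤m+n _ _)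
... | inj₂ refl  = m≤n+m _ _

two-terms≤sumTo : ∀ k (f : ℕ → ℕ) {l₁ l₂} → l₁ < l₂ → l₂ ≤ k → f l₁ + f l₂ ≤ sumTo k f
two-terms≤sumTo zero    f (s≤s _) ()
two-terms≤sumTo (suc k) f {l₁} {l₂} l₁<l₂ l₂≤1+k with m≤n⇒m<n∨m≡n l₂≤1+k
... | inj₁ l₂<1+k = ≤-trans (two-terms≤sumTo k f l₁<l₂ (≤-pred l₂<1+k)) (m≤m+n _ _)
... | inj₂ refl   = +-monoˡ-≤ (f l₂) (term≤sumTo k f (≤-pred l₁<l₂))

sumTo-powers : ∀ d k → sumTo k (d ^_) ≡ suc (mooreOrder d k)
sumTo-powers d zero    = refl
sumTo-powers d (suc k) = cong (_+ d ^ suc k) (sumTo-powers d k)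

module WalkCounts {n : ℕ} (A : Digraph n) where

  if-then-0≡indicator* : ∀ b x → (if b then x else 0) ≡ indicator b * x
  if-then-0≡indicator* true  x = sym (+-identityʳ x)
  if-then-0≡indicator* false x = refl

  walks-suc : ∀ l u v → walks A (suc l) u v ≡ sum (λ w → indicator (A u w) * walks A l w v)
  walks-suc l u v = trans (sumFin≡sum n _) (sum-cong-≗ (λ w → if-then-0≡indicator* (A u w) (walks A l w v)))

  walks-sucʳ : ∀ l u v → walks A (suc l) u v ≡ sum (λ w → walks A l u w * indicator (A w v))
  walks-sucʳ zero u v = begin
    walks A 1 u v                                  ≡⟨ walks-suc 0 u v ⟩
    sum (λ w → indicator (A u w) * δ w v)          ≡⟨ sum-δʳ v (λ w → indicator (A u w)) ⟩
    indicator (A u v)                              ≡⟨ sum-δ u (λ w → indicator (A w v)) ⟨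
    sum (λ w → δ u w * indicator (A w v))          ∎
    where open ≡-Reasoning
  walks-sucʳ (suc l) u v = begin
    walks A (suc (suc l)) u v
      ≡⟨ walks-suc (suc l) u v ⟩
    sum (λ w → indicator (A u w) * walks A (suc l) w v)
      ≡⟨ sum-cong-≗ (λ w → cong (indicator (A u w) *_) (walks-sucʳ l w v)) ⟩
    sum (λ w → indicator (A u w) * sum (λ x → walks A l w x * indicator (A x v)))
      ≡⟨ sum-cong-≗ (λ w → *-distribˡ-sum (indicator (A u w)) (λ x → walks A l w x * indicator (A x v))) ⟩
    sum (λ w → sum (λ x → indicator (A u w) * (walks A l w x * indicator (A x v))))
      ≡⟨ ∑-comm (λ w x → indicator (A u w) * (walks A l w x * indicator (A x v))) ⟩
    sum (λ x → sum (λ w → indicator (A u w) * (walks A l w x * indicator (A x v))))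
      ≡⟨ sum-cong-≗ (λ x → sum-cong-≗ (λ w → *-assoc (indicator (A u w)) (walks A l w x) (indicator (A x v)))) ⟨
    sum (λ x → sum (λ w → indicator (A u w) * walks A l w x * indicator (A x v)))
      ≡⟨ sum-cong-≗ (λ x → *-distribʳ-sum (indicator (A x v)) (λ w → indicator (A u w) * walks A l w x)) ⟨
    sum (λ x → sum (λ w → indicator (A u w) * walks A l w x) * indicator (A x v))
      ≡⟨ sum-cong-≗ (λ x → cong (_* indicator (A x v)) (walks-suc l u x)) ⟨
    sum (λ x → walks A (suc l) u x * indicator (A x v)) ∎
    where open ≡-Reasoning

  outDeg≡sum : ∀ u → outDeg A u ≡ sum (λ w → indicator (A u w))
  outDeg≡sum u = sumFin≡sum n _

  inDeg≡sum : ∀ v → inDeg A v ≡ sum (λ w → indicator (A w v))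
  inDeg≡sum v = sumFin≡sum n _

  sum-walks : ∀ {d} → Diregular A d → ∀ l u → sum (walks A l u) ≡ d ^ l
  sum-walks reg zero    u = trans (sum-cong-≗ (λ w → sym (*-identityʳ (δ u w)))) (sum-δ u (λ _ → 1))
  sum-walks {d} reg (suc l) u = begin
    sum (walks A (suc l) u)
      ≡⟨ sum-cong-≗ (walks-suc l u) ⟩
    sum (λ v → sum (λ w → indicator (A u w) * walks A l w v))
      ≡⟨ ∑-comm (λ v w → indicator (A u w) * walks A l w v) ⟩
    sum (λ w → sum (λ v → indicator (A u w) * walks A l w v))
      ≡⟨ sum-cong-≗ (λ w → *-distribˡ-sum (indicator (A u w)) (walks A l w)) ⟨
    sum (λ w → indicator (A u w) * sum (walks A l w))
      ≡⟨ sum-cong-≗ (λ w → cong (indicator (A u w) *_) (sum-walks reg l w)) ⟩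
    sum (λ w → indicator (A u w) * d ^ l)
      ≡⟨ *-distribʳ-sum (d ^ l) (λ w → indicator (A u w)) ⟨
    sum (λ w → indicator (A u w)) * d ^ l
      ≡⟨ cong (_* d ^ l) (trans (sym (outDeg≡sum u)) (proj₁ (reg u))) ⟩
    d * d ^ l ∎
    where open ≡-Reasoning

  sum-walksUpTo : ∀ {d} → Diregular A d → ∀ k u → sum (walksUpTo A k u) ≡ suc (mooreOrder d k)
  sum-walksUpTo {d} reg k u = begin
    sum (walksUpTo A k u)                 ≡⟨ sum-sumTo-comm k (λ l v → walks A l u v) ⟩
    sumTo k (λ l → sum (walks A l u))     ≡⟨ sumTo-cong k (λ l → sum-walks reg l u) ⟩
    sumTo k (d ^_)                        ≡⟨ sumTo-powers d k ⟩
    suc (mooreOrder d k)                  ∎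
    where open ≡-Reasoning

  walksUpTo-commutes-with-arcs : ∀ k u v →
    sum (λ w → indicator (A u w) * walksUpTo A k w v) ≡ sum (λ w → walksUpTo A k u w * indicator (A w v))
  walksUpTo-commutes-with-arcs k u v = begin
    sum (λ w → indicator (A u w) * walksUpTo A k w v)
      ≡⟨ sum-cong-≗ (λ w → *-distribˡ-sumTo k (indicator (A u w)) (λ l → walks A l w v)) ⟩
    sum (λ w → sumTo k (λ l → indicator (A u w) * walks A l w v))
      ≡⟨ sum-sumTo-comm k (λ l w → indicator (A u w) * walks A l w v) ⟩
    sumTo k (λ l → sum (λ w → indicator (A u w) * walks A l w v))
      ≡⟨ sumTo-cong k (λ l → trans (sym (walks-suc l u v)) (walks-sucʳ l u v)) ⟩
    sumTo k (λ l → sum (λ w → walks A l u w * indicator (A w v)))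
      ≡⟨ sum-sumTo-comm k (λ l w → walks A l u w * indicator (A w v)) ⟨
    sum (λ w → sumTo k (λ l → walks A l u w * indicator (A w v)))
      ≡⟨ sum-cong-≗ (λ w → *-distribʳ-sumTo k (indicator (A w v)) (λ l → walks A l u w)) ⟨
    sum (λ w → walksUpTo A k u w * indicator (A w v)) ∎
    where open ≡-Reasoning

module Walks {n : ℕ} (A : Digraph n) where

  -- A walk of length l from u is recorded by the vector of the l vertices after u.
  IsWalk : ∀ l → Fin n → Fin n → Vec (Fin n) l → Set
  IsWalk zero    u v []       = u ≡ v
  IsWalk (suc l) u v (w ∷ ws) = A u w ≡ true × IsWalk l w v ws

  walkIn-start : ∀ {P l u v} → WalkIn A P l u v → P u
  walkIn-start (nil pu)      = pu
  walkIn-start (cons pu _ _) = pu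

  walkIn⇒IsWalk : ∀ {P l u v} → WalkIn A P l u v → Σ (Vec (Fin n) l) λ ws → IsWalk l u v ws × All P ws
  walkIn⇒IsWalk (nil _)      = [] , refl , []
  walkIn⇒IsWalk (cons _ e W) with walkIn⇒IsWalk W
  ... | ws , isWalk , ps = _ ∷ ws , (e , isWalk) , walkIn-start W ∷ ps

  IsWalk⇒walkIn : ∀ {P l u v ws} → P u → All P ws → IsWalk l u v ws → WalkIn A P l u v
  IsWalk⇒walkIn {ws = []}     pu []        refl           = nil pu
  IsWalk⇒walkIn {ws = _ ∷ _}  pu (pw ∷ ps) (e , isWalk)   = cons pu e (IsWalk⇒walkIn pw ps isWalk)

  PreservesArcs : (Fin n → Fin n) → Set
  PreservesArcs φ = ∀ {x y} → A x y ≡ true → A (φ x) (φ y) ≡ true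

  IsWalk-map : ∀ {φ} → PreservesArcs φ → ∀ {l u v} ws →
               IsWalk l u v ws → IsWalk l (φ u) (φ v) (Vec.map φ ws)
  IsWalk-map φ-arcs []       u≡v          = cong _ u≡v
  IsWalk-map φ-arcs (w ∷ ws) (e , isWalk) = φ-arcs e , IsWalk-map φ-arcs ws isWalk

  tailsVia : ∀ {l} → Fin n → List (Vec (Fin n) (suc l)) → List (Vec (Fin n) l)
  tailsVia w []              = []
  tailsVia w ((x ∷ xs) ∷ T) with x ≟ w
  ... | yes _ = xs ∷ tailsVia w T
  ... | no  _ = tailsVia w T

  ∈-tailsVia⁻ : ∀ {l w} {ws : Vec (Fin n) l} T → ws ∈ tailsVia w T → (w ∷ ws) ∈ T
  ∈-tailsVia⁻ {w = w} ((x ∷ xs) ∷ T) ws∈ with x ≟ w | ws∈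
  ... | yes refl | here refl = here refl
  ... | yes refl | there ws∈′ = there (∈-tailsVia⁻ T ws∈′)
  ... | no  _    | ws∈′       = there (∈-tailsVia⁻ T ws∈′)

  tailsVia-unique : ∀ {l} w (T : List (Vec (Fin n) (suc l))) → Unique T → Unique (tailsVia w T)
  tailsVia-unique w []              []           = []
  tailsVia-unique w ((x ∷ xs) ∷ T) (x∷xs∉T ∷ uT) with x ≟ w
  ... | yes refl = xs∉tails ∷ tailsVia-unique w T uT
    where
    xs∉tails : ListAll.All (λ ys → ¬ xs ≡ ys) (tailsVia x T)
    xs∉tails = ListAll.tabulate λ ys∈ xs≡ys → ListAll.lookup x∷xs∉T (∈-tailsVia⁻ T ys∈) (cong (x ∷_) xs≡ys)
  ... | no  _    = tailsVia-unique w T uT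

  length-tailsVia : ∀ {l} (x : Fin n) xs (T : List (Vec (Fin n) (suc l))) w →
                    length (tailsVia w ((x ∷ xs) ∷ T)) ≡ δ x w + length (tailsVia w T)
  length-tailsVia x xs T w with x ≟ w
  ... | yes _ = refl
  ... | no  _ = refl

  length≡sum-length-tailsVia : ∀ {l} (T : List (Vec (Fin n) (suc l))) →
                               length T ≡ sum (λ w → length (tailsVia w T))
  length≡sum-length-tailsVia []              = sym (sum-replicate-zero n)
  length≡sum-length-tailsVia ((x ∷ xs) ∷ T) = begin
    suc (length T)
      ≡⟨ cong₂ _+_ (sum-δ x (λ _ → 1)) (sym (length≡sum-length-tailsVia T)) ⟨
    sum (λ w → δ x w * 1) + sum (λ w → length (tailsVia w T))
      ≡⟨ ∑-distrib-+ (λ w → δ x w * 1) (λ w → length (tailsVia w T)) ⟨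
    sum (λ w → δ x w * 1 + length (tailsVia w T))
      ≡⟨ sum-cong-≗ (λ w → trans (cong (_+ _) (*-identityʳ (δ x w))) (sym (length-tailsVia x xs T w))) ⟩
    sum (λ w → length (tailsVia w ((x ∷ xs) ∷ T))) ∎
    where open ≡-Reasoning

  unique-walks≤walks : ∀ l {u v} (T : List (Vec (Fin n) l)) → Unique T → ListAll.All (IsWalk l u v) T →
                       length T ≤ walks A l u v
  unique-walks≤walks zero    []            _             _           = z≤n
  unique-walks≤walks zero    ([] ∷ [])     _             (refl ∷ []) = ≤-reflexive (sym (δ-refl _))
  unique-walks≤walks zero    ([] ∷ [] ∷ _) ((≢[] ∷ _) ∷ _) _         = ⊥-elim (≢[] refl)
  unique-walks≤walks (suc l) {u} {v} T uniq walk = begin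
    length T                                          ≡⟨ length≡sum-length-tailsVia T ⟩
    sum (λ w → length (tailsVia w T))                 ≤⟨ sum-mono-≤ fibre-bound ⟩
    sum (λ w → if A u w then walks A l w v else 0)    ≡⟨ sumFin≡sum n _ ⟨
    walks A (suc l) u v                               ∎
    where
    open ≤-Reasoning
    fibre-walks : ∀ w → ListAll.All (λ ws → A u w ≡ true × IsWalk l w v ws) (tailsVia w T)
    fibre-walks w = ListAll.tabulate (λ ws∈ → ListAll.lookup walk (∈-tailsVia⁻ T ws∈))
    fibre-bound : ∀ w → length (tailsVia w T) ≤ (if A u w then walks A l w v else 0)
    fibre-bound w with A u w | tailsVia w T | tailsVia-unique w T uniq | fibre-walks w
    ... | true  | T′ | uniq′ | walk′             = unique-walks≤walks l T′ uniq′ (ListAll.map proj₂ walk′)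
    ... | false | [] | _     | _                 = z≤n
    ... | false | _  | _     | (() , _) ∷ _

  map-fixed⇒fixed : ∀ (φ : Fin n → Fin n) {l} (ws : Vec (Fin n) l) →
                    Vec.map φ ws ≡ ws → All (λ x → φ x ≡ x) ws
  map-fixed⇒fixed φ []       _  = []
  map-fixed⇒fixed φ (w ∷ ws) eq = proj₁ (∷-injective eq) ∷ map-fixed⇒fixed φ ws (proj₂ (∷-injective eq))

  IsWalk-map-fixing : ∀ {φ} → PreservesArcs φ → ∀ {l u v ws} → φ u ≡ u → φ v ≡ v →
                      IsWalk l u v ws → IsWalk l u v (Vec.map φ ws)
  IsWalk-map-fixing {φ} φ-arcs {l} {ws = ws} φu≡u φv≡v walk =
    subst₂ (λ a b → IsWalk l a b (Vec.map φ ws)) φu≡u φv≡v (IsWalk-map φ-arcs ws walk)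

  -- Among the three walks ws, φ ws, φ² ws from u to v two coincide, as there are at most two.
  walk-fixed-by-φ-or-φ² : ∀ {φ l u v ws} → PreservesArcs φ → φ u ≡ u → φ v ≡ v → walks A l u v ≤ 2 →
    IsWalk l u v ws →
    Σ (Vec (Fin n) l) λ ws′ → IsWalk l u v ws′ × (All (λ x → φ x ≡ x) ws′ ⊎ All (λ x → φ (φ x) ≡ x) ws′)
  walk-fixed-by-φ-or-φ² {φ} {l} {u} {v} {ws} φ-arcs φu≡u φv≡v walks≤2 walk
    with ≡-dec-Vec _≟_ (Vec.map φ ws) ws
       | ≡-dec-Vec _≟_ (Vec.map φ (Vec.map φ ws)) (Vec.map φ ws)
       | ≡-dec-Vec _≟_ (Vec.map φ (Vec.map φ ws)) ws
  ... | yes φ-fixes-ws | _ | _ = ws , walk , inj₁ (map-fixed⇒fixed φ ws φ-fixes-ws)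
  ... | no _ | yes φ-fixes-φws | _ =
    Vec.map φ ws , IsWalk-map-fixing φ-arcs φu≡u φv≡v walk ,
    inj₁ (map-fixed⇒fixed φ (Vec.map φ ws) φ-fixes-φws)
  ... | no _ | no _ | yes φ²-fixes-ws =
    ws , walk , inj₂ (map-fixed⇒fixed (φ ∘ φ) ws (trans (map-∘ φ φ ws) φ²-fixes-ws))
  ... | no φws≢ws | no φ²ws≢φws | no φ²ws≢ws =
    ⊥-elim (≤⇒≯ walks≤2 (unique-walks≤walks l three-walks distinct all-walks))
    where
    map-walk : ∀ {ws} → IsWalk l u v ws → IsWalk l u v (Vec.map φ ws)
    map-walk = IsWalk-map-fixing φ-arcs φu≡u φv≡v
    three-walks : List (Vec (Fin n) l)
    three-walks = ws ∷ Vec.map φ ws ∷ Vec.map φ (Vec.map φ ws) ∷ []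
    distinct : Unique three-walks
    distinct = ((φws≢ws ∘ sym) ∷ (φ²ws≢ws ∘ sym) ∷ []) ∷ ((φ²ws≢φws ∘ sym) ∷ []) ∷ [] ∷ []
    all-walks : ListAll.All (IsWalk l u v) three-walks
    all-walks = walk ∷ map-walk walk ∷ map-walk (map-walk walk) ∷ []

  walk⇒1≤walks : ∀ {l u v} ws → IsWalk l u v ws → 1 ≤ walks A l u v
  walk⇒1≤walks ws walk = unique-walks≤walks _ (ws ∷ []) ([] ∷ []) (walk ∷ [])

1≤indicator⇒true : ∀ {b} → 1 ≤ indicator b → b ≡ true
1≤indicator⇒true {true} _ = refl

module AlmostMoore {n d k : ℕ} {A : Digraph n}
                   (order : n ≡ mooreOrder d k) (regular : Diregular A d) (diameter : HasDiameter A k)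
                   (r : Fin n → Fin n) (repeat : ∀ v → IsRepeat A k v (r v)) where
  open WalkCounts A
  open Walks A

  1≤walksUpTo : ∀ u v → 1 ≤ walksUpTo A k u v
  1≤walksUpTo u v with proj₁ diameter u v tt tt
  ... | l , l≤k , W with walkIn⇒IsWalk W
  ...   | ws , walk , _ = ≤-trans (walk⇒1≤walks ws walk) (term≤sumTo k (λ j → walks A j u v) l≤k)

  walksUpTo≡1+δ : ∀ u v → walksUpTo A k u v ≡ 1 + δ (r u) v
  walksUpTo≡1+δ u = excess-at-one-point (walksUpTo A k u) (1≤walksUpTo u)
    (trans (sum-walksUpTo regular k u) (cong suc (sym order))) (≤-reflexive (sym (proj₁ (repeat u))))

  -- AP = PA for the permutation matrix P of r: A(J + P) = (J + P)A by walksUpTo≡1+δ, and AJ = dJ = JA.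
  arcs-into-repeat : ∀ u v → sum (λ x → indicator (A u x) * δ (r x) v) ≡ indicator (A (r u) v)
  arcs-into-repeat u v = +-cancelˡ-≡ d _ _ (begin
    d + sum (λ x → indicator (A u x) * δ (r x) v)
      ≡⟨ cong (_+ sum (λ x → indicator (A u x) * δ (r x) v)) (trans (sym (proj₁ (regular u))) (outDeg≡sum u)) ⟩
    sum (λ x → indicator (A u x)) + sum (λ x → indicator (A u x) * δ (r x) v)
      ≡⟨ ∑-distrib-+ (λ x → indicator (A u x)) (λ x → indicator (A u x) * δ (r x) v) ⟨
    sum (λ x → indicator (A u x) + indicator (A u x) * δ (r x) v)
      ≡⟨ sum-cong-≗ (λ x → trans (cong (_+ indicator (A u x) * δ (r x) v) (sym (*-identityʳ (indicator (A u x)))))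
                          (trans (sym (*-distribˡ-+ (indicator (A u x)) 1 (δ (r x) v)))
                                 (cong (indicator (A u x) *_) (sym (walksUpTo≡1+δ x v))))) ⟩
    sum (λ x → indicator (A u x) * walksUpTo A k x v)
      ≡⟨ walksUpTo-commutes-with-arcs k u v ⟩
    sum (λ x → walksUpTo A k u x * indicator (A x v))
      ≡⟨ sum-cong-≗ (λ x → cong (_* indicator (A x v)) (walksUpTo≡1+δ u x)) ⟩
    sum (λ x → (1 + δ (r u) x) * indicator (A x v))
      ≡⟨ ∑-distrib-+ (λ x → indicator (A x v)) (λ x → δ (r u) x * indicator (A x v)) ⟩
    sum (λ x → indicator (A x v)) + sum (λ x → δ (r u) x * indicator (A x v))
      ≡⟨ cong₂ _+_ (trans (sym (inDeg≡sum v)) (proj₂ (regular v))) (sum-δ (r u) (λ x → indicator (A x v))) ⟩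
    d + indicator (A (r u) v) ∎)
    where open ≡-Reasoning

  repeat-preserves-arcs : PreservesArcs r
  repeat-preserves-arcs {u} {w} u→w = 1≤indicator⇒true (begin
    1                                                  ≡⟨ cong₂ _*_ (cong indicator u→w) (δ-refl (r w)) ⟨
    indicator (A u w) * δ (r w) (r w)                  ≤⟨ term≤sum (λ x → indicator (A u x) * δ (r x) (r w)) w ⟩
    sum (λ x → indicator (A u x) * δ (r x) (r w))      ≡⟨ arcs-into-repeat u (r w) ⟩
    indicator (A (r u) (r w))                          ∎)
    where open ≤-Reasoning

  iter-preserves-arcs : ∀ m → PreservesArcs (iter r m)
  iter-preserves-arcs zero    u→w = u→w
  iter-preserves-arcs (suc m) u→w = repeat-preserves-arcs (iter-preserves-arcs m u→w)

  walks≤2 : ∀ {l} u v → l ≤ k → walks A l u v ≤ 2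
  walks≤2 {l} u v l≤k = begin
    walks A l u v         ≤⟨ term≤sumTo k (λ j → walks A j u v) l≤k ⟩
    walksUpTo A k u v     ≡⟨ walksUpTo≡1+δ u v ⟩
    1 + δ (r u) v         ≤⟨ s≤s (δ≤1 (r u) v) ⟩
    2                     ∎
    where open ≤-Reasoning

  closed-walk⇒self-repeat : ∀ {ℓ w} ws → IsWalk (suc ℓ) w w ws → suc ℓ ≤ k → r w ≡ w
  closed-walk⇒self-repeat {ℓ} {w} ws walk 1+ℓ≤k = 1≤δ⇒≡ (s≤s⁻¹ (begin
    2                                      ≤⟨ +-mono-≤ (≤-reflexive (sym (δ-refl w))) (walk⇒1≤walks ws walk) ⟩
    walks A 0 w w + walks A (suc ℓ) w w    ≤⟨ two-terms≤sumTo k (λ j → walks A j w w) (s≤s z≤n) 1+ℓ≤k ⟩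
    walksUpTo A k w w                      ≡⟨ walksUpTo≡1+δ w w ⟩
    1 + δ (r w) w                          ∎))
    where open ≤-Reasoning

least-witness : ∀ {P : ℕ → Set} → Decidable P → ∀ {M} → P M → Σ ℕ λ m → P m × (∀ j → j < m → ¬ P j)
least-witness P? {zero}  PM = zero , PM , λ _ ()
least-witness P? {suc M} PM with P? zero
... | yes P0 = zero , P0 , λ _ ()
... | no ¬P0 with least-witness (P? ∘ suc) PM
...   | m , Pm , below = suc m , Pm , λ { zero _ → ¬P0 ; (suc j) j<m → below j (s≤s⁻¹ j<m) }

module _ {X : Set} (f : X → X) where

  iter-+ : ∀ a b x → iter f (a + b) x ≡ iter f a (iter f b x)
  iter-+ zero    b x = refl
  iter-+ (suc a) b x = cong f (iter-+ a b x)

  iter-comm : ∀ m x → iter f m (f x) ≡ f (iter f m x)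
  iter-comm m x = trans (sym (iter-+ m 1 x)) (cong (λ j → iter f j x) (+-comm m 1))

  iter-*-fixed : ∀ {m x} q → iter f m x ≡ x → iter f (q * m) x ≡ x
  iter-*-fixed         zero    _   = refl
  iter-*-fixed {m} {x} (suc q) fix = trans (iter-+ m (q * m) x) (trans (cong (iter f m) (iter-*-fixed q fix)) fix)

  iter-∣-fixed : ∀ {m M x} → m ∣ M → iter f m x ≡ x → iter f M x ≡ x
  iter-∣-fixed (divides q refl) = iter-*-fixed q

  iter-collision⇒fixed : ∀ {x m a b} → iter f m x ≡ x → b ≤ m → iter f a x ≡ iter f b x →
                         iter f (m ∸ b + a) x ≡ x
  iter-collision⇒fixed {x} {m} {a} {b} fix b≤m collision = begin
    iter f (m ∸ b + a) x          ≡⟨ iter-+ (m ∸ b) a x ⟩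
    iter f (m ∸ b) (iter f a x)   ≡⟨ cong (iter f (m ∸ b)) collision ⟩
    iter f (m ∸ b) (iter f b x)   ≡⟨ iter-+ (m ∸ b) b x ⟨
    iter f (m ∸ b + b) x          ≡⟨ cong (λ l → iter f l x) (m∸n+n≡m b≤m) ⟩
    iter f m x                    ≡⟨ fix ⟩
    x                             ∎
    where open ≡-Reasoning

module _ {n : ℕ} (f : Fin n → Fin n) where

  ord-exists : ∀ {x M} → 1 ≤ M → iter f M x ≡ x → Σ ℕ (IsOrd f x)
  ord-exists {x} 1≤M fix with least-witness (λ j → (1 ≤? j) ×-dec (iter f j x ≟ x)) (1≤M , fix)
  ... | m , (1≤m , fixm) , below = m , 1≤m , fixm , λ j 1≤j j<m fixj → below j j<m (1≤j , fixj)

  ord-∣ : ∀ {x m M} → IsOrd f x m → iter f M x ≡ x → m ∣ M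
  ord-∣ {x} {suc m} {M} (_ , fix , below) fixM =
    m%n≡0⇒n∣m M (suc m) (n≤0⇒n≡0 (≮⇒≥ λ 0<rem →
      below (M % suc m) 0<rem (m%n<n M (suc m)) remainder-fixed))
    where
    remainder-fixed : iter f (M % suc m) x ≡ x
    remainder-fixed = begin
      iter f (M % suc m) x                             ≡⟨ cong (iter f (M % suc m)) (iter-*-fixed f (M / suc m) fix) ⟨
      iter f (M % suc m) (iter f (M / suc m * suc m) x) ≡⟨ iter-+ f (M % suc m) (M / suc m * suc m) x ⟨
      iter f (M % suc m + M / suc m * suc m) x          ≡⟨ cong (λ j → iter f j x) (m≡m%n+[m/n]*n M (suc m)) ⟨
      iter f M x                                       ≡⟨ fixM ⟩
      x                                                ∎
      where open ≡-Reasoning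

  ord≤n : ∀ {x m} → IsOrd f x m → m ≤ n
  ord≤n {x} {m} (_ , fix , below) = ≮⇒≥ λ n<m →
    let i , j , i<j , collision = pigeonhole n<m (λ i → iter f (toℕ i) x)
    in  below (m ∸ toℕ j + toℕ i)
          (≤-trans (m<n⇒0<n∸m (toℕ<n j)) (m≤m+n _ _))
          (subst (m ∸ toℕ j + toℕ i <_) (m∸n+n≡m (<⇒≤ (toℕ<n j))) (+-monoʳ-< (m ∸ toℕ j) i<j))
          (iter-collision⇒fixed f fix (<⇒≤ (toℕ<n j)) collision)

^-monoʳ-∣ : ∀ c {a b} → a ≤ b → c ^ a ∣ c ^ b
^-monoʳ-∣ c {a} {b} a≤b = divides (c ^ (b ∸ a))
  (trans (cong (c ^_) (sym (m∸n+n≡m a≤b))) (^-distribˡ-+-* c (b ∸ a) a))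

prime-∤⇒coprime : ∀ {p m} → Prime p → ¬ p ∣ m → Coprime m p
prime-∤⇒coprime p-prime p∤m (d∣m , d∣p) with prime⇒irreducible p-prime d∣p
... | inj₁ d≡1 = d≡1
... | inj₂ refl = ⊥-elim (p∤m d∣m)

-- Induction on t: an odd m divides 2^(t-1) b as well, while m = 2q gives q ∣ 2^(t-1) b.
∣2^t*⇒∣2^self* : ∀ t {m} b → 1 ≤ m → m ∣ 2 ^ t * b → m ∣ 2 ^ m * b
∣2^t*⇒∣2^self* zero    {m} b _ m∣b = ∣-trans m∣b (*-monoˡ-∣ b (^-monoʳ-∣ 2 (z≤n {m})))
∣2^t*⇒∣2^self* (suc t) {m} b 1≤m m∣ with 2 ∣? m
... | no 2∤m = ∣2^t*⇒∣2^self* t b 1≤m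
                 (coprime-divisor (prime-∤⇒coprime prime[2] 2∤m) (subst (m ∣_) (*-assoc 2 (2 ^ t) b) m∣))
... | yes (divides zero refl) = contradiction 1≤m λ ()
... | yes (divides q@(suc q′) refl) = ∣-trans 2q∣2^[1+q]*b (*-monoˡ-∣ b (^-monoʳ-∣ 2 1+q≤2q))
  where
  q∣2^t*b : q ∣ 2 ^ t * b
  q∣2^t*b = *-cancelˡ-∣ 2 (subst₂ _∣_ (*-comm q 2) (*-assoc 2 (2 ^ t) b) m∣)
  2q∣2^[1+q]*b : q * 2 ∣ 2 ^ suc q * b
  2q∣2^[1+q]*b = subst₂ _∣_ (*-comm 2 q) (sym (*-assoc 2 (2 ^ q) b))
                   (*-monoʳ-∣ 2 (∣2^t*⇒∣2^self* t b (s≤s z≤n) q∣2^t*b))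
  1+q≤2q : suc q ≤ q * 2
  1+q≤2q = s≤s (s≤s (m≤m*n q′ 2))

module SubdigraphH {n : ℕ} (r : Fin n → Fin n) {α : ℕ} (0<α : 0 < α) where

  fixed⇒InH : ∀ t {x} → iter r (2 ^ t * α) x ≡ x → InH r α x
  fixed⇒InH t fix with ord-exists r (*-mono-≤ (m^n>0 2 t) 0<α) fix
  ... | m , ord = m , ord , t , ord-∣ r ord fix

  InH⇒fixed : ∀ {x} → InH r α x → iter r (2 ^ n * α) x ≡ x
  InH⇒fixed (m , ord@(1≤m , fix , _) , t , m∣2^t*α) = iter-∣-fixed r m∣2^n*α fix
    where
    m∣2^n*α : m ∣ 2 ^ n * α
    m∣2^n*α = ∣-trans (∣2^t*⇒∣2^self* t α 1≤m m∣2^t*α) (*-monoˡ-∣ α (^-monoʳ-∣ 2 (ord≤n r ord)))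

  InH? : Decidable (InH r α)
  InH? x = Dec.map (mk⇔ (fixed⇒InH n) InH⇒fixed) (iter r (2 ^ n * α) x ≟ x)

  doubly-fixed⇒InH : ∀ {x} → iter r (2 ^ n * α) (iter r (2 ^ n * α) x) ≡ x → InH r α x
  doubly-fixed⇒InH {x} fix = fixed⇒InH (suc n) (begin
    iter r (2 ^ suc n * α) x                       ≡⟨ cong (λ j → iter r j x) (*-assoc 2 (2 ^ n) α) ⟩
    iter r (2 ^ n * α + (2 ^ n * α + 0)) x         ≡⟨ cong (λ j → iter r (2 ^ n * α + j) x) (+-identityʳ _) ⟩
    iter r (2 ^ n * α + 2 ^ n * α) x               ≡⟨ iter-+ r (2 ^ n * α) (2 ^ n * α) x ⟩
    iter r (2 ^ n * α) (iter r (2 ^ n * α) x)      ≡⟨ fix ⟩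
    x                                              ∎)
    where open ≡-Reasoning

  self-repeat⇒InH : ∀ {w} → r w ≡ w → InH r α w
  self-repeat⇒InH fix = fixed⇒InH 0 (iter-∣-fixed r (1∣ (2 ^ 0 * α)) fix)

  InH-closed-under-r : ∀ {w} → InH r α w → InH r α (r w)
  InH-closed-under-r {w} hw = fixed⇒InH n (trans (iter-comm r (2 ^ n * α) w) (cong r (InH⇒fixed hw)))

  non-self-repeat-in-H : ¬ (∀ w → InH r α w ⇔ IsSelfRepeat r w) → Σ (Fin n) λ w → InH r α w × r w ≢ w
  non-self-repeat-in-H H≢Ck
    with ¬∀⟶∃¬ n (λ w → InH r α w → r w ≡ w) (λ w → InH? w →-dec (r w ≟ w))
                (λ H⊆Ck → H≢Ck λ w → mk⇔ (H⊆Ck w) self-repeat⇒InH)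
  ... | w , ¬H⇒Ck =
    w , decidable-stable (InH? w) (λ ¬hw → ¬H⇒Ck (⊥-elim ∘ ¬hw)) , λ self → ¬H⇒Ck (λ _ → self)

module DiameterOfH {n d k : ℕ} {A : Digraph n}
                   (order : n ≡ mooreOrder d k) (regular : Diregular A d) (diameter : HasDiameter A k)
                   (r : Fin n → Fin n) (repeat : ∀ v → IsRepeat A k v (r v)) {α : ℕ} (0<α : 0 < α) where
  open Walks A
  open AlmostMoore order regular diameter r repeat
  open SubdigraphH r 0<α

  H-walks-within-k : ∀ u v → InH r α u → InH r α v → ∃[ l ] (l ≤ k × WalkIn A (InH r α) l u v)
  H-walks-within-k u v hu hv with proj₁ diameter u v tt tt
  ... | l , l≤k , W with walkIn⇒IsWalk W
  ... | ws , walk , _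
    with walk-fixed-by-φ-or-φ² (iter-preserves-arcs (2 ^ n * α)) (InH⇒fixed hu) (InH⇒fixed hv)
                               (walks≤2 u v l≤k) walk
  ... | ws′ , walk′ , fixed =
    l , l≤k , IsWalk⇒walkIn hu ([ VecAll.map (fixed⇒InH n) , VecAll.map doubly-fixed⇒InH ]′ fixed) walk′

  FarPair : Set
  FarPair = ∃[ u ] ∃[ v ] (InH r α u × InH r α v × (∀ ℓ → ℓ < k → ¬ WalkIn A (InH r α) ℓ u v))

  far-pair-from-walk : ∀ {w l} → r w ≢ w → InH r α w → WalkIn A (InH r α) l w (r w) → FarPair
  far-pair-from-walk {w} rw≢w hw W with walkIn⇒IsWalk W
  ... | []    , w≡rw      , _      = ⊥-elim (rw≢w (sym w≡rw))
  ... | x ∷ _ , (w→x , _) , hx ∷ _ = x , w , hx , hw , no-short-return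
    where
    no-short-return : ∀ ℓ → ℓ < k → ¬ WalkIn A (InH r α) ℓ x w
    no-short-return ℓ ℓ<k X with walkIn⇒IsWalk X
    ... | ws , walk , _ = rw≢w (closed-walk⇒self-repeat (x ∷ ws) (w→x , walk) ℓ<k)

  H≢Ck⇒far-pair : ¬ (∀ w → InH r α w ⇔ IsSelfRepeat r w) → FarPair
  H≢Ck⇒far-pair H≢Ck =
    let w , hw , rw≢w = non-self-repeat-in-H H≢Ck
    in  far-pair-from-walk rw≢w hw (proj₂ (proj₂ (H-walks-within-k w (r w) hw (InH-closed-under-r hw))))

corollary3 : (n d k : ℕ) (A : Digraph n) → IsAlmostMoore n d k A →
             (r : Fin n → Fin n) → (∀ v → IsRepeat A k v (r v)) →
             (α : ℕ) → 1 < α →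
             ¬ (∀ w → InH r α w ⇔ IsSelfRepeat r w) →
             HasDiameterIn A (InH r α) k
corollary3 n d k A (_ , _ , order , regular , diameter) r repeat α 1<α H≢Ck =
  H-walks-within-k , H≢Ck⇒far-pair H≢Ck
  where open DiameterOfH order regular diameter r repeat (<⇒≤ 1<α)
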